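{- For every integer $\gamma\ge0$, the rewrite rule $\to_\gamma$ on syntax trees of $\mathbf{Free}(\{\hookleftarrow_a,\hookrightarrow_a:a\in[\gamma]\})$ generated by $$\hookleftarrow_a\circ_1\hookrightarrow_{a'}\to_\gamma\hookrightarrow_{a'}\circ_2\hookleftarrow_a,\quad \hookleftarrow_a\circ_1\hookleftarrow_{a'}\to_\gamma\hookleftarrow_{a\downarrow a'}\circ_2\hookleftarrow_a,\quad \hookrightarrow_a\circ_2\hookrightarrow_{a'}\to_\gamma\hookrightarrow_{a\downarrow a'}\circ_1\hookrightarrow_a\qquad(a,a'\in[\gamma])$$ is convergent (terminating and confluent), and the generating series $\mathcal{G}_\gamma(t)$ of its normal forms counted by arity satisfies $\mathcal{G}_\gamma(t)=t+2\gamma t\,\mathcal{G}_\gamma(t)+\gamma^2t\,\mathcal{G}_\gamma(t)^2$.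
   Context: $\mathbf{Free}(G)$ is the free nonsymmetric operad on a set $G$ of binary generators, whose elements are linear combinations of syntax trees (planar binary trees with internal nodes labeled by $G$; the arity is the number of leaves, the single leaf being the arity-1 tree). $[n]=\{1,\dots,n\}$, $a\downarrow a'=\min(a,a')$. The rewrite rule $\to_\gamma$ acts on syntax trees by replacing any subtree consisting of two adjacent internal nodes matching a left-hand side by the corresponding right-hand side (keeping the three attached subtrees in order). Normal forms are syntax trees to which no rewriting applies. -}

module Defs where

open import Data.Nat using (ℕ; zero; suc; _+_; _*_; _^_)
open import Data.Fin using (Fin; zero; suc)
open import Data.List using (List; map; upTo)
open import Data.Nat.ListAction using (sum)
open import Relation.Binary.PropositionalEquality using (_≡_)
open import Relation.Binary.Rewriting using (IsNormalForm)

-- [γ] is represented by Fin γ (order-preserving relabelling 1..γ ↦ 0..γ-1).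
-- a ↓ a' = min(a, a') on Fin γ
_↓_ : ∀ {γ} → Fin γ → Fin γ → Fin γ
zero  ↓ _     = zero
suc a ↓ zero  = zero
suc a ↓ suc b = suc (a ↓ b)

data Gen (γ : ℕ) : Set where
  ↩ : Fin γ → Gen γ
  ↪ : Fin γ → Gen γ

data Tree (γ : ℕ) : Set where
  leaf : Tree γ
  node : Gen γ → Tree γ → Tree γ → Tree γ

arity : ∀ {γ} → Tree γ → ℕ
arity leaf         = 1
arity (node _ l r) = arity l + arity r

-- x ∘₁ y : node x (node y A B) C ;  x ∘₂ y : node x A (node y B C)
-- One rewrite step →γ, applied at any position of a syntax tree.
data _→γ_ {γ : ℕ} : Tree γ → Tree γ → Set where
  rule₁ : ∀ a a' A B C →
    node (↩ a) (node (↪ a') A B) C →γ node (↪ a') A (node (↩ a) B C)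
  rule₂ : ∀ a a' A B C →
    node (↩ a) (node (↩ a') A B) C →γ node (↩ (a ↓ a')) A (node (↩ a) B C)
  rule₃ : ∀ a a' A B C →
    node (↪ a) A (node (↪ a') B C) →γ node (↪ (a ↓ a')) (node (↪ a) A B) C
  congˡ : ∀ g {l l'} r → l →γ l' → node g l r →γ node g l' r
  congʳ : ∀ g l {r r'} → r →γ r' → node g l r →γ node g l r'

-- normal forms of arity n (proof fields irrelevant, so equality is equality of trees)
record NormalFormOfArity (γ n : ℕ) : Set where
  constructor nf
  field
    tree     : Tree γ
    .isArity : arity tree ≡ n
    .isNF    : IsNormalForm (_→γ_ {γ}) tree

Series : Set
Series = ℕ → ℕ

_⊕_ : Series → Series → Series
(f ⊕ g) n = f n + g n

_⊛_ : Series → Series → Series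
(f ⊛ g) n = sum (map (λ i → f i * g (n Data.Nat.∸ i)) (upTo (suc n)))

_·_ : ℕ → Series → Series
(c · f) n = c * f n

t : Series
t zero          = 0
t (suc zero)    = 1
t (suc (suc _)) = 0

module Submission where

-- Termination: measure a tree by the pair (Σ over ↩ nodes of the size of their left
-- subtree, Σ over ↪ nodes of the size of their right subtree).  The first two rules
-- strictly decrease the first component; the third keeps it and decreases the second.
-- Since the measure is compositional and steps preserve size, it decreases under
-- contexts too.  Confluence then follows by Newman's lemma from local confluence; in
-- the overlaps of a rule with itself the labels are joined by associativity of ↓.
--
-- Counting: a tree is normal iff it is leaf, ↩ a leaf R, ↪ a L leaf or ↪ a L (↩ b leaf R)
-- with L and R normal.  Hence, if H counts normal forms of every arity below n, the
-- right-hand side of the equation evaluated at H counts those of arity n.  Iterating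
-- the equation from 0 therefore yields a series G counting all normal forms, and G
-- satisfies the equation because both sides count the same finite set.

open import Defs
open import Data.Nat using (ℕ; zero; suc; _+_; _*_; _^_; _∸_; _<_; _≤_; _≟_; s≤s; s≤s⁻¹; z≤n)
open import Data.Nat.Properties
  using (+-assoc; +-comm; +-identityʳ; *-identityʳ; ≤-refl; <-≤-trans; m≤n+m; m+n∸n≡m; m∸n+n≡m;
         +-monoʳ-<; +-monoˡ-<; ∸-monoʳ-<; <-isStrictPartialOrder)
open import Data.Nat.Induction using (<-wellFounded)
open import Data.Nat.Tactic.RingSolver using (solve-∀)
open import Data.Fin using (Fin)
open import Data.Fin.Properties using (¬Fin0; +↔⊎; *↔×)
open import Data.Fin.Permutation using (↔⇒≡)
open import Data.List using (applyUpTo)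
open import Data.List.Properties using (map-applyUpTo)
open import Data.Nat.ListAction using (sum)
open import Data.Product using (Σ; ∃; _×_; _,_; proj₁; proj₂)
open import Data.Product.Relation.Binary.Lex.Strict using (×-Lex; ×-wellFounded; ×-isStrictPartialOrder)
open import Data.Sum using (_⊎_; inj₁; inj₂; [_,_]′)
open import Data.Empty using (⊥; ⊥-elim; ⊥-elim-irr)
open import Function.Base using (_on_; id)
open import Function.Bundles using (_↔_; mk↔ₛ′; Inverse)
open import Function.Properties.Inverse using (↔-refl; ↔-trans; ↔-sym)
open import Data.Sum.Function.Propositional using (_⊎-↔_)
open import Data.Product.Function.NonDependent.Propositional using (_×-↔_)
open import Induction.WellFounded using (WellFounded; module Subrelation)
import Relation.Binary.Construct.On as On
open import Relation.Binary.Structures using (IsStrictPartialOrder)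
open import Relation.Binary.PropositionalEquality
open import Relation.Binary.Rewriting using (StronglyNormalizing; Confluent; WeaklyConfluent; IsNormalForm; sn&wcr⇒cr)
open import Relation.Binary.Construct.Closure.ReflexiveTransitive using (Star; ε; _◅_; gmap)
open import Relation.Binary.Construct.Closure.Transitive using (Plus; [_]; _∼⁺⟨_⟩_)
open import Relation.Nullary.Decidable using (recompute)

↓-assoc : ∀ {k} (a b c : Fin k) → (a ↓ b) ↓ c ≡ a ↓ (b ↓ c)
↓-assoc Fin.zero    b           c           = refl
↓-assoc (Fin.suc a) Fin.zero    c           = refl
↓-assoc (Fin.suc a) (Fin.suc b) Fin.zero    = refl
↓-assoc (Fin.suc a) (Fin.suc b) (Fin.suc c) = cong Fin.suc (↓-assoc a b c)

-- Termination

infix 4 _<ₗₑₓ_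
infixl 6 _⊞_

_<ₗₑₓ_ : ℕ × ℕ → ℕ × ℕ → Set
_<ₗₑₓ_ = ×-Lex _≡_ _<_ _<_

<ₗₑₓ-wellFounded : WellFounded _<ₗₑₓ_
<ₗₑₓ-wellFounded = ×-wellFounded <-wellFounded <-wellFounded

<ₗₑₓ-trans : ∀ {p q r} → p <ₗₑₓ q → q <ₗₑₓ r → p <ₗₑₓ r
<ₗₑₓ-trans = IsStrictPartialOrder.trans (×-isStrictPartialOrder <-isStrictPartialOrder <-isStrictPartialOrder)

_⊞_ : ℕ × ℕ → ℕ × ℕ → ℕ × ℕ
p ⊞ q = proj₁ p + proj₁ q , proj₂ p + proj₂ q

⊞-monoʳ-<ₗₑₓ : ∀ w {p q} → p <ₗₑₓ q → w ⊞ p <ₗₑₓ w ⊞ q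
⊞-monoʳ-<ₗₑₓ w (inj₁ p₁<q₁)          = inj₁ (+-monoʳ-< (proj₁ w) p₁<q₁)
⊞-monoʳ-<ₗₑₓ w (inj₂ (p₁≡q₁ , p₂<q₂)) = inj₂ (cong (proj₁ w +_) p₁≡q₁ , +-monoʳ-< (proj₂ w) p₂<q₂)

⊞-monoˡ-<ₗₑₓ : ∀ w {p q} → p <ₗₑₓ q → p ⊞ w <ₗₑₓ q ⊞ w
⊞-monoˡ-<ₗₑₓ w (inj₁ p₁<q₁)          = inj₁ (+-monoˡ-< (proj₁ w) p₁<q₁)
⊞-monoˡ-<ₗₑₓ w (inj₂ (p₁≡q₁ , p₂<q₂)) = inj₂ (cong (_+ proj₁ w) p₁≡q₁ , +-monoˡ-< (proj₂ w) p₂<q₂)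

<-by-excess : ∀ {m n} k → m ≡ suc k + n → n < m
<-by-excess {n = n} k refl = s≤s (m≤n+m n k)

suc-reassoc : ∀ x y z → suc (x + suc (y + z)) ≡ suc (suc (x + y) + z)
suc-reassoc = solve-∀

module _ {γ : ℕ} where

  nodes : Tree γ → ℕ
  nodes leaf         = 0
  nodes (node _ l r) = suc (nodes l + nodes r)

  weight : Gen γ → Tree γ → Tree γ → ℕ × ℕ
  weight (↩ _) l _ = nodes l , 0
  weight (↪ _) _ r = 0 , nodes r

  measure : Tree γ → ℕ × ℕ
  measure leaf         = 0 , 0
  measure (node g l r) = weight g l r ⊞ (measure l ⊞ measure r)

  nodes-preserved : ∀ {s s'} → s →γ s' → nodes s' ≡ nodes s
  nodes-preserved (rule₁ _ _ A B C) = suc-reassoc (nodes A) (nodes B) (nodes C)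
  nodes-preserved (rule₂ _ _ A B C) = suc-reassoc (nodes A) (nodes B) (nodes C)
  nodes-preserved (rule₃ _ _ A B C) = sym (suc-reassoc (nodes A) (nodes B) (nodes C))
  nodes-preserved (congˡ _ r st) = cong (λ n → suc (n + nodes r)) (nodes-preserved st)
  nodes-preserved (congʳ _ l st) = cong (λ n → suc (nodes l + n)) (nodes-preserved st)

  weight-congˡ : ∀ g {l l'} r → nodes l' ≡ nodes l → weight g l' r ≡ weight g l r
  weight-congˡ (↩ _) r eq = cong (_, 0) eq
  weight-congˡ (↪ _) r eq = refl

  weight-congʳ : ∀ g l {r r'} → nodes r' ≡ nodes r → weight g l r' ≡ weight g l r
  weight-congʳ (↩ _) l eq = refl
  weight-congʳ (↪ _) l eq = cong (0 ,_) eq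

  measure-decreases : ∀ {s s'} → s →γ s' → measure s' <ₗₑₓ measure s
  measure-decreases (rule₁ _ _ A B C) =
    inj₁ (<-by-excess (nodes A) (excess (nodes A) (nodes B) (proj₁ (measure A)) (proj₁ (measure B)) (proj₁ (measure C))))
    where excess : ∀ x y a b c → suc (x + y) + ((a + b) + c) ≡ suc x + (a + (y + (b + c)))
          excess = solve-∀
  measure-decreases (rule₂ _ _ A B C) =
    inj₁ (<-by-excess (nodes A) (excess (nodes A) (nodes B) (proj₁ (measure A)) (proj₁ (measure B)) (proj₁ (measure C))))
    where excess : ∀ x y a b c → suc (x + y) + ((x + (a + b)) + c) ≡ suc x + (x + (a + (y + (b + c))))
          excess = solve-∀
  measure-decreases (rule₃ _ _ A B C) =
    inj₂ (+-assoc (proj₁ (measure A)) (proj₁ (measure B)) (proj₁ (measure C)) ,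
          <-by-excess (nodes C) (excess (nodes B) (nodes C) (proj₂ (measure A)) (proj₂ (measure B)) (proj₂ (measure C))))
    where excess : ∀ y z a b c → suc (y + z) + (a + (z + (b + c))) ≡ suc z + (z + ((y + (a + b)) + c))
          excess = solve-∀
  measure-decreases (congˡ g r st) rewrite weight-congˡ g r (nodes-preserved st) =
    ⊞-monoʳ-<ₗₑₓ (weight g _ r) (⊞-monoˡ-<ₗₑₓ (measure r) (measure-decreases st))
  measure-decreases (congʳ g l st) rewrite weight-congʳ g l (nodes-preserved st) =
    ⊞-monoʳ-<ₗₑₓ (weight g l _) (⊞-monoʳ-<ₗₑₓ (measure l) (measure-decreases st))

  measure-decreases⁺ : ∀ {s s'} → Plus _→γ_ s s' → measure s' <ₗₑₓ measure s
  measure-decreases⁺ [ st ]           = measure-decreases st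
  measure-decreases⁺ (_ ∼⁺⟨ p ⟩ q) = <ₗₑₓ-trans (measure-decreases⁺ q) (measure-decreases⁺ p)

  measure-wellFounded : WellFounded (_<ₗₑₓ_ on measure)
  measure-wellFounded = On.wellFounded measure <ₗₑₓ-wellFounded

  →γ-stronglyNormalizing : StronglyNormalizing (_→γ_ {γ})
  →γ-stronglyNormalizing = Subrelation.wellFounded measure-decreases measure-wellFounded

  →γ⁺-stronglyNormalizing : StronglyNormalizing (Plus (_→γ_ {γ}))
  →γ⁺-stronglyNormalizing = Subrelation.wellFounded measure-decreases⁺ measure-wellFounded

-- Confluence

module _ {γ : ℕ} where

  infix 4 _—↠_

  _—↠_ : Tree γ → Tree γ → Set
  _—↠_ = Star _→γ_

  Joinable : Tree γ → Tree γ → Set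
  Joinable x y = ∃ λ d → x —↠ d × y —↠ d

  Joinable-sym : ∀ {x y} → Joinable x y → Joinable y x
  Joinable-sym (d , x↠d , y↠d) = d , y↠d , x↠d

  step : ∀ {x y} → x →γ y → x —↠ y
  step st = st ◅ ε

  congˡ* : ∀ g {l l'} r → l —↠ l' → node g l r —↠ node g l' r
  congˡ* g r = gmap (λ l → node g l r) (congˡ g r)

  congʳ* : ∀ g l {r r'} → r —↠ r' → node g l r —↠ node g l r'
  congʳ* g l = gmap (node g l) (congʳ g l)

  rule₂-≡ : ∀ {b : Fin γ} a a' A B C → a ↓ a' ≡ b → node (↩ a) (node (↩ a') A B) C →γ node (↩ b) A (node (↩ a) B C)
  rule₂-≡ a a' A B C refl = rule₂ a a' A B C

  rule₃-≡ : ∀ {b : Fin γ} a a' A B C → a ↓ a' ≡ b → node (↪ a) A (node (↪ a') B C) →γ node (↪ b) (node (↪ a) A B) C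
  rule₃-≡ a a' A B C refl = rule₃ a a' A B C

  rule₁-joinable : ∀ a a' A B C {u} → node (↩ a) (node (↪ a') A B) C →γ u →
                   Joinable (node (↪ a') A (node (↩ a) B C)) u
  rule₁-joinable a a' A B C (rule₁ _ _ _ _ _) = _ , ε , ε
  rule₁-joinable a a' A B C (congˡ _ _ (rule₃ _ c _ B₁ B₂)) =
    _ , congʳ (↪ a') A (rule₁ a c B₁ B₂ C) ◅ step (rule₃ a' c A B₁ _) , step (rule₁ a _ _ B₂ C)
  rule₁-joinable a a' A B C (congˡ _ _ (congˡ _ _ st)) =
    _ , step (congˡ (↪ a') _ st) , step (rule₁ _ _ _ _ _)
  rule₁-joinable a a' A B C (congˡ _ _ (congʳ _ _ st)) =
    _ , step (congʳ (↪ a') A (congˡ (↩ a) C st)) , step (rule₁ _ _ _ _ _)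
  rule₁-joinable a a' A B C (congʳ _ _ st) =
    _ , step (congʳ (↪ a') A (congʳ (↩ a) B st)) , step (rule₁ _ _ _ _ _)

  rule₂-joinable : ∀ a a' A B C {u} → node (↩ a) (node (↩ a') A B) C →γ u →
                   Joinable (node (↩ (a ↓ a')) A (node (↩ a) B C)) u
  rule₂-joinable a a' A B C (rule₂ _ _ _ _ _) = _ , ε , ε
  rule₂-joinable a a' A B C (congˡ _ _ (rule₁ _ c A₁ A₂ _)) =
    _ , step (rule₁ (a ↓ a') c A₁ A₂ _) , rule₁ a c A₁ _ C ◅ step (congʳ (↪ c) A₁ (rule₂ a a' A₂ B C))
  rule₂-joinable a a' A B C (congˡ _ _ (rule₂ _ c A₁ A₂ _)) =
    _ , step (rule₂-≡ (a ↓ a') c A₁ A₂ _ (↓-assoc a a' c)) ,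
        rule₂ a (a' ↓ c) A₁ _ C ◅ step (congʳ _ A₁ (rule₂ a a' A₂ B C))
  rule₂-joinable a a' A B C (congˡ _ _ (congˡ _ _ st)) =
    _ , step (congˡ _ _ st) , step (rule₂ _ _ _ _ _)
  rule₂-joinable a a' A B C (congˡ _ _ (congʳ _ _ st)) =
    _ , step (congʳ _ A (congˡ (↩ a) C st)) , step (rule₂ _ _ _ _ _)
  rule₂-joinable a a' A B C (congʳ _ _ st) =
    _ , step (congʳ _ A (congʳ (↩ a) B st)) , step (rule₂ _ _ _ _ _)

  rule₃-joinable : ∀ a a' A B C {u} → node (↪ a) A (node (↪ a') B C) →γ u →
                   Joinable (node (↪ (a ↓ a')) (node (↪ a) A B) C) u
  rule₃-joinable a a' A B C (rule₃ _ _ _ _ _) = _ , ε , ε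
  rule₃-joinable a a' A B C (congˡ _ _ st) =
    _ , step (congˡ _ C (congˡ (↪ a) B st)) , step (rule₃ _ _ _ _ _)
  rule₃-joinable a a' A B C (congʳ _ _ (rule₃ _ c _ C₁ C₂)) =
    _ , step (rule₃-≡ (a ↓ a') c _ C₁ C₂ (↓-assoc a a' c)) ,
        rule₃ a (a' ↓ c) A _ C₂ ◅ step (congˡ _ C₂ (rule₃ a a' A B C₁))
  rule₃-joinable a a' A B C (congʳ _ _ (congˡ _ _ st)) =
    _ , step (congˡ _ C (congʳ (↪ a) A st)) , step (rule₃ _ _ _ _ _)
  rule₃-joinable a a' A B C (congʳ _ _ (congʳ _ _ st)) =
    _ , step (congʳ _ _ st) , step (rule₃ _ _ _ _ _)

  →γ-weaklyConfluent : WeaklyConfluent (_→γ_ {γ})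
  →γ-weaklyConfluent (rule₁ a a' A B C) st = rule₁-joinable a a' A B C st
  →γ-weaklyConfluent (rule₂ a a' A B C) st = rule₂-joinable a a' A B C st
  →γ-weaklyConfluent (rule₃ a a' A B C) st = rule₃-joinable a a' A B C st
  →γ-weaklyConfluent st@(congˡ _ _ _) (rule₁ a a' A B C) = Joinable-sym (rule₁-joinable a a' A B C st)
  →γ-weaklyConfluent st@(congˡ _ _ _) (rule₂ a a' A B C) = Joinable-sym (rule₂-joinable a a' A B C st)
  →γ-weaklyConfluent st@(congˡ _ _ _) (rule₃ a a' A B C) = Joinable-sym (rule₃-joinable a a' A B C st)
  →γ-weaklyConfluent st@(congʳ _ _ _) (rule₁ a a' A B C) = Joinable-sym (rule₁-joinable a a' A B C st)
  →γ-weaklyConfluent st@(congʳ _ _ _) (rule₂ a a' A B C) = Joinable-sym (rule₂-joinable a a' A B C st)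
  →γ-weaklyConfluent st@(congʳ _ _ _) (rule₃ a a' A B C) = Joinable-sym (rule₃-joinable a a' A B C st)
  →γ-weaklyConfluent (congˡ g r st) (congˡ _ _ st') with →γ-weaklyConfluent st st'
  ... | _ , l↠d , l'↠d = _ , congˡ* g r l↠d , congˡ* g r l'↠d
  →γ-weaklyConfluent (congˡ g r st) (congʳ _ _ st') = _ , step (congʳ g _ st') , step (congˡ g _ st)
  →γ-weaklyConfluent (congʳ g l st) (congˡ _ _ st') = _ , step (congˡ g _ st') , step (congʳ g _ st)
  →γ-weaklyConfluent (congʳ g l st) (congʳ _ _ st') with →γ-weaklyConfluent st st'
  ... | _ , r↠d , r'↠d = _ , congʳ* g l r↠d , congʳ* g l r'↠d

  →γ-confluent : Confluent (_→γ_ {γ})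
  →γ-confluent = sn&wcr⇒cr →γ⁺-stronglyNormalizing →γ-weaklyConfluent

-- Counting

infix 4 _HasSize_

_HasSize_ : Set → ℕ → Set
A HasSize k = Fin k ↔ A

hasSize-↔ : ∀ {A B k} → A ↔ B → A HasSize k → B HasSize k
hasSize-↔ A↔B hA = ↔-trans hA A↔B

hasSize-⊎ : ∀ {A B m n} → A HasSize m → B HasSize n → (A ⊎ B) HasSize m + n
hasSize-⊎ hA hB = ↔-trans +↔⊎ (hA ⊎-↔ hB)

hasSize-× : ∀ {A B m n} → A HasSize m → B HasSize n → (A × B) HasSize m * n
hasSize-× hA hB = ↔-trans *↔× (hA ×-↔ hB)

empty-hasSize : ∀ {A} → (A → ⊥) → A HasSize 0
empty-hasSize ¬a = mk↔ₛ′ (λ ()) (λ a → ⊥-elim (¬a a)) (λ a → ⊥-elim (¬a a)) (λ ())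

×-hasSize-0ˡ : ∀ {A B} → A HasSize 0 → (A × B) HasSize 0
×-hasSize-0ˡ hA = empty-hasSize (λ { (a , _) → ¬Fin0 (Inverse.from hA a) })

-- The bound is irrelevant, so an element is determined by its index and value.
record Σ≤ (n : ℕ) (Y : ℕ → Set) : Set where
  constructor ⟨_∣_∣_⟩
  field
    index    : ℕ
    .bounded : index ≤ n
    value    : Y index

Σ≤-zero-↔ : ∀ {Y} → Σ≤ 0 Y ↔ (Y 0 ⊎ ⊥)
Σ≤-zero-↔ {Y} = mk↔ₛ′ to from (λ { (inj₁ y) → refl }) (λ { ⟨ zero ∣ _ ∣ y ⟩ → refl })
  where to : Σ≤ 0 Y → Y 0 ⊎ ⊥
        to ⟨ zero ∣ _ ∣ y ⟩ = inj₁ y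
        from : Y 0 ⊎ ⊥ → Σ≤ 0 Y
        from (inj₁ y) = ⟨ 0 ∣ z≤n ∣ y ⟩

Σ≤-suc-↔ : ∀ {n Y} → Σ≤ (suc n) Y ↔ (Y 0 ⊎ Σ≤ n (λ i → Y (suc i)))
Σ≤-suc-↔ {n} {Y} = mk↔ₛ′ to from to∘from from∘to
  where to : Σ≤ (suc n) Y → Y 0 ⊎ Σ≤ n (λ i → Y (suc i))
        to ⟨ zero  ∣ _  ∣ y ⟩ = inj₁ y
        to ⟨ suc i ∣ le ∣ y ⟩ = inj₂ ⟨ i ∣ s≤s⁻¹ le ∣ y ⟩
        from : Y 0 ⊎ Σ≤ n (λ i → Y (suc i)) → Σ≤ (suc n) Y
        from (inj₁ y)             = ⟨ 0 ∣ z≤n ∣ y ⟩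
        from (inj₂ ⟨ i ∣ le ∣ y ⟩) = ⟨ suc i ∣ s≤s le ∣ y ⟩
        to∘from : ∀ x → to (from x) ≡ x
        to∘from (inj₁ _) = refl
        to∘from (inj₂ _) = refl
        from∘to : ∀ x → from (to x) ≡ x
        from∘to ⟨ zero  ∣ _ ∣ _ ⟩ = refl
        from∘to ⟨ suc _ ∣ _ ∣ _ ⟩ = refl

Σ≤-hasSize : ∀ n {Y} (y : ℕ → ℕ) → (∀ i → i ≤ n → Y i HasSize y i) → Σ≤ n Y HasSize sum (applyUpTo y (suc n))
Σ≤-hasSize zero    y h = hasSize-↔ (↔-sym Σ≤-zero-↔) (hasSize-⊎ (h 0 z≤n) (empty-hasSize (λ ())))
Σ≤-hasSize (suc n) y h = hasSize-↔ (↔-sym Σ≤-suc-↔)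
  (hasSize-⊎ (h 0 z≤n) (Σ≤-hasSize n (λ i → y (suc i)) (λ i i≤n → h (suc i) (s≤s i≤n))))

infixr 7 _⊗_

_⊗_ : (ℕ → Set) → (ℕ → Set) → ℕ → Set
(P ⊗ Q) n = Σ≤ n (λ i → P i × Q (n ∸ i))

⊗-hasSize : ∀ {P Q} {p q : Series} n → (∀ i → i ≤ n → (P i × Q (n ∸ i)) HasSize p i * q (n ∸ i)) →
            (P ⊗ Q) n HasSize (p ⊛ q) n
⊗-hasSize {P} {Q} {p} {q} n h =
  subst ((P ⊗ Q) n HasSize_) (sym (cong sum (map-applyUpTo id (λ i → p i * q (n ∸ i)) (suc n))))
        (Σ≤-hasSize n _ h)

m≡n∸o⇒m+o≡n : ∀ {m n o} → m ≡ n ∸ o → o ≤ n → m + o ≡ n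
m≡n∸o⇒m+o≡n {o = o} m≡n∸o o≤n = trans (cong (_+ o) m≡n∸o) (m∸n+n≡m o≤n)

m+n≡o⇒n≤o : ∀ m {n o} → m + n ≡ o → n ≤ o
m+n≡o⇒n≤o m {n} m+n≡o = subst (n ≤_) m+n≡o (m≤n+m n m)

m+n≡o⇒m≡o∸n : ∀ m n {o} → m + n ≡ o → m ≡ o ∸ n
m+n≡o⇒m≡o∸n m n m+n≡o = trans (sym (m+n∸n≡m m n)) (cong (_∸ n) m+n≡o)

X : ℕ → Set
X n = n ≡ 1

X-hasSize : ∀ n → X n HasSize t n
X-hasSize zero          = empty-hasSize (λ ())
X-hasSize (suc zero)    = mk↔ₛ′ (λ _ → refl) (λ _ → Fin.zero) (λ { refl → refl }) (λ { Fin.zero → refl ; (Fin.suc ()) })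
X-hasSize (suc (suc n)) = empty-hasSize (λ ())

X⊗-hasSize : ∀ {P} (p : Series) m → (1 ≤ m → P (m ∸ 1) HasSize p (m ∸ 1)) → (X ⊗ P) m HasSize (t ⊛ p) m
X⊗-hasSize {P} p m h = ⊗-hasSize {X} {P} {t} {p} m λ where
  zero          _   → ×-hasSize-0ˡ (X-hasSize 0)
  (suc zero)    1≤m → hasSize-× (X-hasSize 1) (h 1≤m)
  (suc (suc i)) _   → ×-hasSize-0ˡ (X-hasSize (suc (suc i)))

-- Normal forms

module _ {γ : ℕ} where

  Normal : Tree γ → Set
  Normal = IsNormalForm _→γ_

  data NormalShape : Tree γ → Set where
    leaf     : NormalShape leaf
    ↩-leaf   : ∀ a r → NormalShape (node (↩ a) leaf r)
    ↪-leaf   : ∀ a l → NormalShape (node (↪ a) l leaf)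
    ↪-↩-leaf : ∀ a b l r → NormalShape (node (↪ a) l (node (↩ b) leaf r))

  normalShape : ∀ {s} → .(Normal s) → NormalShape s
  normalShape {leaf}                                            _  = leaf
  normalShape {node (↩ a) leaf r}                               _  = ↩-leaf a r
  normalShape {node (↩ a) (node (↩ b) A B) C}                   ns = ⊥-elim-irr (ns (_ , rule₂ a b A B C))
  normalShape {node (↩ a) (node (↪ b) A B) C}                   ns = ⊥-elim-irr (ns (_ , rule₁ a b A B C))
  normalShape {node (↪ a) l leaf}                               _  = ↪-leaf a l
  normalShape {node (↪ a) A (node (↪ b) B C)}                   ns = ⊥-elim-irr (ns (_ , rule₃ a b A B C))
  normalShape {node (↪ a) l (node (↩ b) leaf r)}                _  = ↪-↩-leaf a b l r
  normalShape {node (↪ a) l (node (↩ b) (node (↩ c) A B) C)}    ns = ⊥-elim-irr (ns (_ , congʳ _ l (rule₂ b c A B C)))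
  normalShape {node (↪ a) l (node (↩ b) (node (↪ c) A B) C)}    ns = ⊥-elim-irr (ns (_ , congʳ _ l (rule₁ b c A B C)))

  leaf-normal : Normal leaf
  leaf-normal (_ , ())

  normal-left : ∀ {g l r} → Normal (node g l r) → Normal l
  normal-left ns (_ , st) = ns (_ , congˡ _ _ st)

  normal-right : ∀ {g l r} → Normal (node g l r) → Normal r
  normal-right ns (_ , st) = ns (_ , congʳ _ _ st)

  ↩-leaf-normal : ∀ a {r} → Normal r → Normal (node (↩ a) leaf r)
  ↩-leaf-normal a nr (_ , congʳ _ _ st) = nr (_ , st)

  ↪-leaf-normal : ∀ a {l} → Normal l → Normal (node (↪ a) l leaf)
  ↪-leaf-normal a nl (_ , congˡ _ _ st) = nl (_ , st)

  ↪-↩-leaf-normal : ∀ a b {l r} → Normal l → Normal r → Normal (node (↪ a) l (node (↩ b) leaf r))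
  ↪-↩-leaf-normal a b nl nr (_ , congˡ _ _ st) = nl (_ , st)
  ↪-↩-leaf-normal a b nl nr (_ , congʳ _ _ st) = ↩-leaf-normal b nr (_ , st)

X⊗-arity : ∀ {x i} → x ≡ i ∸ 1 → 1 ≤ i → suc x ≡ i
X⊗-arity {x} x≡i∸1 1≤i = trans (+-comm 1 x) (m≡n∸o⇒m+o≡n x≡i∸1 1≤i)

module _ (γ : ℕ) where

  NF : ℕ → Set
  NF = NormalFormOfArity γ

  -- The summands are the normal shapes leaf; ↩ a leaf R and ↪ a L leaf; ↪ a L (↩ b leaf R).
  Shapes : ℕ → Set
  Shapes n = X n ⊎ Gen γ × (X ⊗ NF) n ⊎ (Fin γ × Fin γ) × ((X ⊗ NF) ⊗ NF) n

  fromShape : ∀ {n} → Shapes n → NF n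
  fromShape (inj₁ n≡1) = nf leaf (sym n≡1) leaf-normal
  fromShape (inj₂ (inj₁ (↩ a , ⟨ _ ∣ 1≤n ∣ refl , nf r ar nr ⟩))) =
    nf (node (↩ a) leaf r) (trans (+-comm 1 (arity r)) (m≡n∸o⇒m+o≡n ar 1≤n)) (↩-leaf-normal a nr)
  fromShape (inj₂ (inj₁ (↪ a , ⟨ _ ∣ 1≤n ∣ refl , nf l al nl ⟩))) =
    nf (node (↪ a) l leaf) (m≡n∸o⇒m+o≡n al 1≤n) (↪-leaf-normal a nl)
  fromShape (inj₂ (inj₂ ((a , b) , ⟨ i ∣ i≤n ∣ ⟨ _ ∣ 1≤i ∣ refl , nf r ar nr ⟩ , nf l al nl ⟩))) =
    nf (node (↪ a) l (node (↩ b) leaf r))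
       (trans (cong (arity l +_) (X⊗-arity ar 1≤i)) (m≡n∸o⇒m+o≡n al i≤n))
       (↪-↩-leaf-normal a b nl nr)

  toShape : ∀ {n} → NF n → Shapes n
  toShape {n} (nf s ar ns) with normalShape ns
  ... | leaf = inj₁ (sym (recompute (1 ≟ n) ar))
  ... | ↩-leaf a r = inj₂ (inj₁ (↩ a , ⟨ 1 ∣ subst (1 ≤_) ar (s≤s z≤n) ∣ refl , nf r (cong (_∸ 1) ar) (normal-right ns) ⟩))
  ... | ↪-leaf a l = inj₂ (inj₁ (↪ a , ⟨ 1 ∣ m+n≡o⇒n≤o (arity l) ar ∣ refl , nf l (m+n≡o⇒m≡o∸n (arity l) 1 ar) (normal-left ns) ⟩))
  ... | ↪-↩-leaf a b l r =
    inj₂ (inj₂ ((a , b) , ⟨ suc (arity r) ∣ m+n≡o⇒n≤o (arity l) ar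
                          ∣ ⟨ 1 ∣ s≤s z≤n ∣ refl , nf r refl (normal-right (normal-right ns)) ⟩ ,
                            nf l (m+n≡o⇒m≡o∸n (arity l) (suc (arity r)) ar) (normal-left ns) ⟩))

  fromShape∘toShape : ∀ {n} (s : NF n) → fromShape (toShape s) ≡ s
  fromShape∘toShape (nf s _ ns) with normalShape ns
  ... | leaf             = refl
  ... | ↩-leaf _ _       = refl
  ... | ↪-leaf _ _       = refl
  ... | ↪-↩-leaf _ _ _ _ = refl

  toShape∘fromShape : ∀ {n} (d : Shapes n) → toShape (fromShape d) ≡ d
  toShape∘fromShape (inj₁ refl)        = refl
  toShape∘fromShape (inj₂ (inj₁ (↩ _ , ⟨ _ ∣ _ ∣ refl , _ ⟩))) = refl
  toShape∘fromShape (inj₂ (inj₁ (↪ _ , ⟨ _ ∣ _ ∣ refl , _ ⟩))) = refl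
  -- Here the index i equals suc (arity r) only irrelevantly; recompute makes that usable.
  toShape∘fromShape (inj₂ (inj₂ (ab , ⟨ i ∣ i≤n ∣ ⟨ _ ∣ 1≤i ∣ refl , nf r ar nr ⟩ , l ⟩))) =
    roundtrip ab i≤n 1≤i r ar nr l (recompute (suc (arity r) ≟ i) (X⊗-arity ar 1≤i))
    where
    roundtrip : ∀ {n i} ab .(i≤n : i ≤ n) .(1≤i : 1 ≤ i) r .(ar : arity r ≡ i ∸ 1) .(nr : Normal r) (l : NF (n ∸ i)) →
                suc (arity r) ≡ i →
                let d = inj₂ (inj₂ (ab , ⟨ i ∣ i≤n ∣ ⟨ 1 ∣ 1≤i ∣ refl , nf r ar nr ⟩ , l ⟩)) in toShape (fromShape d) ≡ d
    roundtrip _ _ _ _ _ _ _ refl = refl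

  Shapes↔NF : ∀ {n} → Shapes n ↔ NF n
  Shapes↔NF = mk↔ₛ′ fromShape toShape fromShape∘toShape toShape∘fromShape

  Φ : Series → Series
  Φ H = t ⊕ (((2 * γ) · (t ⊛ H)) ⊕ ((γ ^ 2) · ((t ⊛ H) ⊛ H)))

  Gen-hasSize : Gen γ HasSize 2 * γ
  Gen-hasSize = subst (Gen γ HasSize_) (cong (γ +_) (sym (+-identityʳ γ)))
                      (hasSize-↔ Fin⊎Fin↔Gen (hasSize-⊎ ↔-refl ↔-refl))
    where
    Fin⊎Fin↔Gen : (Fin γ ⊎ Fin γ) ↔ Gen γ
    Fin⊎Fin↔Gen = mk↔ₛ′ [ ↩ , ↪ ]′ (λ { (↩ a) → inj₁ a ; (↪ a) → inj₂ a })
                        (λ { (↩ _) → refl ; (↪ _) → refl }) (λ { (inj₁ _) → refl ; (inj₂ _) → refl })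

  Fin²-hasSize : (Fin γ × Fin γ) HasSize γ ^ 2
  Fin²-hasSize = subst ((Fin γ × Fin γ) HasSize_) (cong (γ *_) (sym (*-identityʳ γ))) (hasSize-× ↔-refl ↔-refl)

  Shapes-hasSize : ∀ n (H : Series) → (∀ m → m < n → NF m HasSize H m) → Shapes n HasSize Φ H n
  Shapes-hasSize n H counts =
    hasSize-⊎ (X-hasSize n) (hasSize-⊎ (hasSize-× Gen-hasSize (X⊗NF-hasSize n ≤-refl)) (hasSize-× Fin²-hasSize X⊗NF⊗NF-hasSize))
    where
    X⊗NF-hasSize : ∀ m → m ≤ n → (X ⊗ NF) m HasSize (t ⊛ H) m
    X⊗NF-hasSize m m≤n = X⊗-hasSize {NF} H m (λ 1≤m → counts (m ∸ 1) (<-≤-trans (∸-monoʳ-< (s≤s z≤n) 1≤m) m≤n))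

    X⊗NF⊗NF-hasSize : ((X ⊗ NF) ⊗ NF) n HasSize ((t ⊛ H) ⊛ H) n
    X⊗NF⊗NF-hasSize = ⊗-hasSize {X ⊗ NF} {NF} {t ⊛ H} {H} n λ where
      zero    _   → ×-hasSize-0ˡ (X⊗NF-hasSize 0 z≤n)
      (suc i) i<n → hasSize-× (X⊗NF-hasSize (suc i) i<n) (counts (n ∸ suc i) (∸-monoʳ-< (s≤s z≤n) i<n))

  NF-hasSize : ∀ n (H : Series) → (∀ m → m < n → NF m HasSize H m) → NF n HasSize Φ H n
  NF-hasSize n H counts = hasSize-↔ Shapes↔NF (Shapes-hasSize n H counts)

  Φ-iterate : ℕ → Series
  Φ-iterate zero    _ = 0
  Φ-iterate (suc k)   = Φ (Φ-iterate k)

  Φ-iterate-hasSize : ∀ k m → m < k → NF m HasSize Φ-iterate k m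
  Φ-iterate-hasSize (suc k) m (s≤s m≤k) =
    NF-hasSize m (Φ-iterate k) (λ j j<m → Φ-iterate-hasSize k j (<-≤-trans j<m m≤k))

  G : Series
  G n = Φ-iterate (suc n) n

  G-hasSize : ∀ n → NF n HasSize G n
  G-hasSize n = Φ-iterate-hasSize (suc n) n ≤-refl

  G-fixpoint : ∀ n → G n ≡ Φ G n
  G-fixpoint n = ↔⇒≡ (↔-trans (G-hasSize n) (↔-sym (NF-hasSize n G (λ m _ → G-hasSize m))))

lemma4p1p1 : (γ : ℕ) →
    StronglyNormalizing (_→γ_ {γ}) × Confluent (_→γ_ {γ}) ×
    Σ Series (λ G →
      ((n : ℕ) → Fin (G n) ↔ NormalFormOfArity γ n) ×
      ((n : ℕ) → G n ≡ (t ⊕ (((2 * γ) · (t ⊛ G)) ⊕ ((γ ^ 2) · ((t ⊛ G) ⊛ G)))) n))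
lemma4p1p1 γ = →γ-stronglyNormalizing , →γ-confluent , G γ , G-hasSize γ , G-fixpoint γ
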